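{- (Cofinality of prefix points.) If $r:\mathbb{S}\to\mathbb{S}$ is an interactive realizer, then for every $s\in\mathbb{S}$ there is $s'\in\mathrm{Prefix}(r)$ with $s\sqsubseteq s'$; in particular $\mathrm{Prefix}(r)$ is non-empty and cofinal in $\mathbb{S}$.
   Context: $\mathbb{S}$ is the set of states (finite sets of triples $\langle P,\vec m,n\rangle$, $P$ a primitive recursive predicate symbol, with $P(\vec m,n)$ true in the standard model and at most one $n$ for each $(P,\vec m)$), ordered by inclusion $\sqsubseteq$; two states are compatible if their union is a state. A weakly increasing sequence is $\sigma:\mathbb{N}\to\mathbb{S}$ with $\sigma(i)\sqsubseteq\sigma(j)$ for $i\le j$. A map $r:\mathbb{S}\to\mathbb{S}$ is strongly convergent if for every weakly increasing $\sigma$ the sequence $r(\sigma(i))$ is eventually constant. An interactive realizer is a strongly convergent $r:\mathbb{S}\to\mathbb{S}$ such that $r(s)$ is compatible with $s$ and $r(s)\cap s=\emptyset$ for all $s$. $\mathrm{Prefix}(r)=\{s\in\mathbb{S}\mid r(s)\sqsubseteq s\}$. -}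

module Defs where

open import Data.Nat using (ℕ; zero; suc; _≤_)
open import Data.Fin using (Fin)
open import Data.Vec using (Vec; []; _∷_; lookup; map)
open import Data.Product using (Σ; _×_; _,_; ∃)
open import Data.List using (List)
open import Data.List.Membership.Propositional using (_∈_)
open import Relation.Binary.PropositionalEquality using (_≡_)
open import Relation.Nullary using (¬_)

data PR : ℕ → Set where
  Z    : ∀ {k} → PR k
  S    : PR 1
  Proj : ∀ {k} → Fin k → PR k
  Comp : ∀ {k j} → PR j → Vec (PR k) j → PR k
  Rec  : ∀ {k} → PR k → PR (suc (suc k)) → PR (suc k)

mutual
  eval : ∀ {k} → PR k → Vec ℕ k → ℕ
  eval Z xs = 0
  eval S (x ∷ []) = suc x
  eval (Proj i) xs = lookup xs i
  eval (Comp f gs) xs = eval f (evalAll gs xs)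
  eval (Rec g h) (zero ∷ xs) = eval g xs
  eval (Rec g h) (suc n ∷ xs) = eval h (n ∷ eval (Rec g h) (n ∷ xs) ∷ xs)

  evalAll : ∀ {k j} → Vec (PR k) j → Vec ℕ k → Vec ℕ j
  evalAll [] xs = []
  evalAll (g ∷ gs) xs = eval g xs ∷ evalAll gs xs

-- A primitive recursive predicate symbol of arity k is a primitive
-- recursive characteristic function; P(xs) holds in the standard model
-- iff its value is nonzero.
PredSym : ℕ → Set
PredSym k = PR k

Holds : ∀ {k} → PredSym k → Vec ℕ k → Set
Holds P xs = ¬ (eval P xs ≡ 0)

record Triple : Set where
  constructor ⟨_,_,_⟩
  field
    {arity} : ℕ
    sym  : PredSym (suc arity)
    args : Vec ℕ arity
    val  : ℕ
open Triple public

TrueTriple : Triple → Set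
TrueTriple ⟨ P , ms , n ⟩ = Holds P (n ∷ ms)

-- Finite sets of triples are represented by lists, up to mutual inclusion.
_⊆ₗ_ : List Triple → List Triple → Set
xs ⊆ₗ ys = ∀ {t} → t ∈ xs → t ∈ ys

IsState : List Triple → Set
IsState xs =
  (∀ {t} → t ∈ xs → TrueTriple t) ×
  (∀ {k} {P : PredSym (suc k)} {ms : Vec ℕ k} {n n'} →
     ⟨ P , ms , n ⟩ ∈ xs → ⟨ P , ms , n' ⟩ ∈ xs → n ≡ n')

record 𝕊 : Set where
  constructor state
  field
    elems   : List Triple
    isState : IsState elems
open 𝕊 public

infix 4 _⊑_ _≐_
_⊑_ : 𝕊 → 𝕊 → Set
s ⊑ s' = elems s ⊆ₗ elems s'

_≐_ : 𝕊 → 𝕊 → Set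
s ≐ s' = (s ⊑ s') × (s' ⊑ s)

Compatible : 𝕊 → 𝕊 → Set
Compatible s s' = IsState (elems s Data.List.++ elems s')
  where import Data.List

Disjoint : 𝕊 → 𝕊 → Set
Disjoint s s' = ∀ {t} → t ∈ elems s → ¬ (t ∈ elems s')

WeaklyIncreasing : (ℕ → 𝕊) → Set
WeaklyIncreasing σ = ∀ i j → i ≤ j → σ i ⊑ σ j

EventuallyConstant : (ℕ → 𝕊) → Set
EventuallyConstant τ = ∃ λ N → ∀ i → N ≤ i → τ i ≐ τ N

Extensional : (𝕊 → 𝕊) → Set
Extensional r = ∀ {s s'} → s ≐ s' → r s ≐ r s'

StronglyConvergent : (𝕊 → 𝕊) → Set
StronglyConvergent r =
  ∀ (σ : ℕ → 𝕊) → WeaklyIncreasing σ → EventuallyConstant (λ i → r (σ i))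

record InteractiveRealizer (r : 𝕊 → 𝕊) : Set where
  field
    extensional : Extensional r
    convergent  : StronglyConvergent r
    compatible  : ∀ s → Compatible (r s) s
    disjoint    : ∀ s → Disjoint (r s) s

Prefix : (𝕊 → 𝕊) → 𝕊 → Set
Prefix r s = r s ⊑ s

module Submission where

-- Since r t is compatible
-- with t, the union  t ⊕ r t  is again a state extending both t and r t.
-- Iterating t ↦ t ⊕ r t from s yields a weakly increasing sequence of
-- states (the orbit of s), so by strong convergence r is eventually
-- constant along it, say from stage N on.  Then
--     r (orbit (N+1)) ≐ r (orbit N) ⊑ orbit N ⊕ r (orbit N) = orbit (N+1),
-- i.e. orbit (N+1) is a prefix point of r above s.

open import Defs
open import Data.Product using (Σ; _×_; _,_; proj₁)
open import Data.Nat using (ℕ; zero; suc; _≤′_; ≤′-refl; ≤′-step; z≤n)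
open import Data.Nat.Properties using (≤⇒≤′; n≤1+n)
open import Data.List using (_++_)
open import Data.List.Membership.Propositional.Properties using (∈-++⁺ˡ; ∈-++⁺ʳ)

stepwise⇒weaklyIncreasing : (σ : ℕ → 𝕊) → (∀ i → σ i ⊑ σ (suc i)) →
                            WeaklyIncreasing σ
stepwise⇒weaklyIncreasing σ grows i j i≤j = chain (≤⇒≤′ i≤j)
  where
  chain : ∀ {k} → i ≤′ k → σ i ⊑ σ k
  chain ≤′-refl                  p = p
  chain {suc k} (≤′-step i≤′k) p = grows k (chain i≤′k p)

module Extension (r : 𝕊 → 𝕊) (realizer : InteractiveRealizer r) where
  open InteractiveRealizer realizer

  extend : 𝕊 → 𝕊
  extend t = state (elems (r t) ++ elems t) (compatible t)

  ⊑-extend : ∀ t → t ⊑ extend t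
  ⊑-extend t = ∈-++⁺ʳ (elems (r t))

  r⊑extend : ∀ t → r t ⊑ extend t
  r⊑extend t = ∈-++⁺ˡ

  stable⇒prefix : ∀ t → r (extend t) ⊑ r t → Prefix r (extend t)
  stable⇒prefix t stable p = r⊑extend t (stable p)

  orbit : 𝕊 → ℕ → 𝕊
  orbit s zero    = s
  orbit s (suc i) = extend (orbit s i)

  orbit-increasing : ∀ s → WeaklyIncreasing (orbit s)
  orbit-increasing s =
    stepwise⇒weaklyIncreasing (orbit s) (λ i → ⊑-extend (orbit s i))

proposition6p3 : (r : 𝕊 → 𝕊) → InteractiveRealizer r →
    (s : 𝕊) → Σ 𝕊 (λ s' → Prefix r s' × s ⊑ s')
proposition6p3 r realizer s =
  prefixAfterStabilisation (convergent (orbit s) (orbit-increasing s))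
  where
  open InteractiveRealizer realizer
  open Extension r realizer

  prefixAfterStabilisation : EventuallyConstant (λ i → r (orbit s i)) →
                             Σ 𝕊 (λ s' → Prefix r s' × s ⊑ s')
  prefixAfterStabilisation (N , constantFromN) =
    orbit s (suc N) ,
    stable⇒prefix (orbit s N) (proj₁ (constantFromN (suc N) (n≤1+n N))) ,
    orbit-increasing s 0 (suc N) z≤n
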